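{- Let $x=(x_1,\dots,x_5)$ be an integer Büchi sequence of length $5$ such that $(x_1,x_2,x_3)$ and $(x_3,x_4,x_5)$ both lie in the $H$-orbit of the same $\delta\in\{(-1,0,1),(2,1,0)\}$, and let $M_x$ be as defined in the context. If $M_x$ has length at most $1$, then $x$ is trivial.
   Context: An integer Büchi sequence of length $N$ is $(x_1,\dots,x_N)\in\mathbb{Z}^N$ with $x_{i+2}^2-2x_{i+1}^2+x_i^2=2$ for $1\le i\le N-2$; it is trivial if there is $m\in\mathbb{Z}$ with $x_i^2=(m+i)^2$ for all $i$. Let $B=\begin{pmatrix}3&4&0\\2&3&0\\0&0&1\end{pmatrix}$, $J=\begin{pmatrix}0&0&1\\0&1&0\\1&0&0\end{pmatrix}$, and let $H$ be the subgroup of $\mathrm{GL}_3(\mathbb{Z})$ generated by $B$ and $J$, acting on column vectors. For $x$ as in the claim, there are unique $M_1,M_3\in H$ with $(x_1,x_2,x_3)^T=M_1\delta$ and $(x_3,x_4,x_5)^T=M_3\delta$; set $M_x=JM_3M_1^{ -1}$ (so $M_x(x_1,x_2,x_3)^T=(x_5,x_4,x_3)^T$). Every element of $H$ other than $I,J$ can be written uniquely as $J^{\ell}B^{n_k}JB^{n_{k-1}}J\cdots JB^{n_1}J^{r}$ with $k\ge1$, all $n_i$ nonzero integers and $\ell,r\in\{0,1\}$; its length is $k$. The elements $I$ and $J$ have length $0$. -}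

module Defs where

open import Data.Nat using (ℕ; zero; suc)
open import Data.Integer using (ℤ; +_; -[1+_]; _+_; _*_; -_)
open import Data.Fin using (Fin)
open import Data.Vec using (Vec; []; _∷_; lookup; tabulate)
open import Data.Product using (Σ; _×_; ∃)
open import Data.Sum using (_⊎_)
open import Relation.Binary.PropositionalEquality using (_≡_)

Vec3 : Set
Vec3 = Vec ℤ 3

Mat3 : Set
Mat3 = Vec (Vec ℤ 3) 3

sum3 : (Fin 3 → ℤ) → ℤ
sum3 f = f Fin.zero + (f (Fin.suc Fin.zero) + f (Fin.suc (Fin.suc Fin.zero)))
  where import Data.Fin as Fin

_·_ : Mat3 → Mat3 → Mat3
M · N = tabulate λ i → tabulate λ j → sum3 λ k → lookup (lookup M i) k * lookup (lookup N k) j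

infixl 7 _·_

_▷_ : Mat3 → Vec3 → Vec3
M ▷ v = tabulate λ i → sum3 λ k → lookup (lookup M i) k * lookup v k

I3 : Mat3
I3 = (+ 1 ∷ + 0 ∷ + 0 ∷ []) ∷ (+ 0 ∷ + 1 ∷ + 0 ∷ []) ∷ (+ 0 ∷ + 0 ∷ + 1 ∷ []) ∷ []

B : Mat3
B = (+ 3 ∷ + 4 ∷ + 0 ∷ []) ∷ (+ 2 ∷ + 3 ∷ + 0 ∷ []) ∷ (+ 0 ∷ + 0 ∷ + 1 ∷ []) ∷ []

Binv : Mat3
Binv = (+ 3 ∷ - + 4 ∷ + 0 ∷ []) ∷ (- + 2 ∷ + 3 ∷ + 0 ∷ []) ∷ (+ 0 ∷ + 0 ∷ + 1 ∷ []) ∷ []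

J : Mat3
J = (+ 0 ∷ + 0 ∷ + 1 ∷ []) ∷ (+ 0 ∷ + 1 ∷ + 0 ∷ []) ∷ (+ 1 ∷ + 0 ∷ + 0 ∷ []) ∷ []

_^ᴹ_ : Mat3 → ℕ → Mat3
M ^ᴹ zero = I3
M ^ᴹ suc n = M · (M ^ᴹ n)

Bpow : ℤ → Mat3
Bpow (+ n) = B ^ᴹ n
Bpow -[1+ n ] = Binv ^ᴹ suc n

Jpow : Fin 2 → Mat3
Jpow Fin.zero = I3
  where import Data.Fin as Fin
Jpow (Fin.suc Fin.zero) = J
  where import Data.Fin as Fin

-- H = subgroup of GL₃(ℤ) generated by B and J (J⁻¹ = J),
-- i.e. all finite products of B, B⁻¹, J.
data InH : Mat3 → Set where
  H-I    : InH I3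
  H-B    : ∀ {M} → InH M → InH (B · M)
  H-Binv : ∀ {M} → InH M → InH (Binv · M)
  H-J    : ∀ {M} → InH M → InH (J · M)

-- Elements of length at most 1: I, J (length 0) and J^ℓ B^n J^r with n ≠ 0
-- (length 1); together exactly the matrices J^ℓ B^n J^r with n ∈ ℤ.
LengthAtMostOne : Mat3 → Set
LengthAtMostOne M = Σ (Fin 2) λ ℓ → Σ ℤ λ n → Σ (Fin 2) λ r → M ≡ Jpow ℓ · Bpow n · Jpow r

δ₁ δ₂ : Vec3
δ₁ = - + 1 ∷ + 0 ∷ + 1 ∷ []
δ₂ = + 2 ∷ + 1 ∷ + 0 ∷ []

sq : ℤ → ℤ
sq a = a * a

IsBuchi5 : ℤ → ℤ → ℤ → ℤ → ℤ → Set
IsBuchi5 x₁ x₂ x₃ x₄ x₅ =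
  (sq x₃ + - (+ 2 * sq x₂) + sq x₁ ≡ + 2) ×
  (sq x₄ + - (+ 2 * sq x₃) + sq x₂ ≡ + 2) ×
  (sq x₅ + - (+ 2 * sq x₄) + sq x₃ ≡ + 2)

Trivial5 : ℤ → ℤ → ℤ → ℤ → ℤ → Set
Trivial5 x₁ x₂ x₃ x₄ x₅ = ∃ λ m →
  (sq x₁ ≡ sq (m + + 1)) × (sq x₂ ≡ sq (m + + 2)) × (sq x₃ ≡ sq (m + + 3)) ×
  (sq x₄ ≡ sq (m + + 4)) × (sq x₅ ≡ sq (m + + 5))

-- Every power Bⁿ acts on the first two coordinates as a Pell rotation
-- (a, b) ↦ (p a + 2q b, q a + p b) with p² − 2q² = 1, fixing the third.  As M₁
-- lies in H, its right inverse cancels it, so M_x sends (x₁,x₂,x₃) to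
-- (x₅,x₄,x₃).  Writing M_x = J^ℓ Bⁿ J^r and reading off one coordinate leaves
-- four shapes: x₃ = x₁, x₅ = x₃, x₅ = x₁, or x₄ = q x₁ + p x₂ for a Pell pair.
-- In the first three, the Büchi equations make two neighbouring squares differ
-- by one, so they are 0 and 1.  In the last, they become the binary quadratic
-- equation (q²+2)x₁² + 2pq x₁x₂ + (2q²−2)x₂² = 6: for q = 0 and |q| = 2 it
-- factors, |q| ∈ {1,3,4,5,6} admit no Pell partner p, and for |q| ≥ 7 the form
-- is so steep that |x₁| ≤ 3 and |x₂| ≤ 2, leaving a finite check.  Each case
-- ends with x₁², x₂² being consecutive squares, which the recurrence propagates.
module Submission where

open import Defs
open import Data.Bool using (T)
open import Data.Empty using (⊥-elim)
import Data.Fin as Fin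
open import Data.Fin using (Fin; #_)
open import Data.List using () renaming (_∷_ to _∷ₗ_; [] to []ₗ)
open import Data.Nat as ℕ using (ℕ; zero; suc)
import Data.Nat.Properties as ℕₚ
open import Data.Product using (Σ; _,_; proj₁; proj₂)
open import Data.Sum using (_⊎_; inj₁; inj₂)
open import Data.Vec using ([]; _∷_; lookup; tabulate)
open import Data.Vec.Properties using (lookup∘tabulate; tabulate-cong)
open import Relation.Binary.PropositionalEquality
  using (_≡_; _≢_; refl; sym; trans; cong; cong₂; subst; module ≡-Reasoning)

module NaturalSquares where
  open import Data.Nat
  open import Data.Nat.Properties
  open import Data.Nat.Tactic.RingSolver using (solve-∀)
  open import Relation.Binary.Definitions using (tri<; tri≈; tri>)
  open import Relation.Nullary using (yes; no)

  square-injective : ∀ m n → m * m ≡ n * n → m ≡ n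
  square-injective m n eq with <-cmp m n
  ... | tri< m<n _ _ = ⊥-elim (<⇒≢ (*-mono-< m<n m<n) eq)
  ... | tri≈ _ m≡n _ = m≡n
  ... | tri> _ _ n<m = ⊥-elim (<⇒≢ (*-mono-< n<m n<m) (sym eq))

  no-square-between : ∀ k c n → k * k < c → c < suc k * suc k → n * n ≢ c
  no-square-between k c n k²<c c<sk² n²≡c with n ≤? k
  ... | yes n≤k = <⇒≱ k²<c (subst (_≤ k * k) n²≡c (*-mono-≤ n≤k n≤k))
  ... | no  n≰k = <⇒≱ c<sk² (subst (suc k * suc k ≤_) n²≡c (*-mono-≤ (≰⇒> n≰k) (≰⇒> n≰k)))

  not-square : ∀ k c n → {T (k * k <ᵇ c)} → {T (c <ᵇ suc k * suc k)} → n * n ≢ c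
  not-square k c n {k²<c} {c<sk²} = no-square-between k c n (<ᵇ⇒< _ _ k²<c) (<ᵇ⇒< _ _ c<sk²)

  square-successor : ∀ a b → a * a ≡ b * b + 1 → b ≡ 0
  square-successor a zero    _  = refl
  square-successor a (suc k) eq = ⊥-elim (no-square-between (suc k) _ a (m<m+n _ z<s) gap eq)
    where
    expand : ∀ k → suc (suc k) * suc (suc k) ≡ suc (suc k * suc k + 1) + (k + suc k)
    expand = solve-∀
    gap : suc k * suc k + 1 < suc (suc k) * suc (suc k)
    gap = subst (suc k * suc k + 1 <_) (sym (expand k)) (m≤m+n _ _)

  root-bound : ∀ n k c → n * n ≤ c → c < suc k * suc k → n ≤ k
  root-bound n k c n²≤c c<sk² with n ≤? k
  ... | yes n≤k = n≤k
  ... | no  n≰k = ⊥-elim (<⇒≱ c<sk² (≤-trans (*-mono-≤ (≰⇒> n≰k) (≰⇒> n≰k)) n²≤c))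

  -- If k·T + c = U + T·S with c < T, then S ≤ k: the term T·S cannot exceed
  -- k·T by as much as T.
  steep-bound : ∀ k c T U S → c < T → k * T + c ≡ U + T * S → S ≤ k
  steep-bound k c T U S c<T eq with S ≤? k
  ... | yes S≤k = S≤k
  ... | no  S≰k = ⊥-elim (<-irrefl refl (begin-strict
    k * T + c   <⟨ +-monoʳ-< (k * T) c<T ⟩
    k * T + T   ≡⟨ sym (trans (*-suc T k) (trans (+-comm T (T * k)) (cong (_+ T) (*-comm T k)))) ⟩
    T * suc k   ≤⟨ *-monoʳ-≤ T (≰⇒> S≰k) ⟩
    T * S       ≤⟨ m≤n+m (T * S) U ⟩
    U + T * S   ≡⟨ sym eq ⟩
    k * T + c   ∎))
    where open ≤-Reasoning

open NaturalSquares

open import Data.Integer using (ℤ; +_; -[1+_]; _+_; _-_; _*_; -_; ∣_∣)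
open import Data.Integer.Properties using (+-injective; pos-+; pos-*; +◃n≡+n; ∣i∣≡0⇒i≡0; *-cancelˡ-≡)
open import Data.Integer.Tactic.RingSolver using (solve-∀; solve)

vec3-cong : ∀ {a b c a′ b′ c′ : ℤ} → a ≡ a′ → b ≡ b′ → c ≡ c′ →
  (a ∷ b ∷ c ∷ []) ≡ (a′ ∷ b′ ∷ c′ ∷ [])
vec3-cong refl refl refl = refl

coordinate : ∀ {u v : Vec3} (i : Fin 3) → u ≡ v → lookup u i ≡ lookup v i
coordinate i = cong (λ w → lookup w i)

sum3-cong : ∀ {f g : Fin 3 → ℤ} → (∀ k → f k ≡ g k) → sum3 f ≡ sum3 g
sum3-cong f≡g = cong₂ _+_ (f≡g (# 0)) (cong₂ _+_ (f≡g (# 1)) (f≡g (# 2)))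

sum3-swap : ∀ (a : Fin 3 → ℤ) (n : Fin 3 → Fin 3 → ℤ) (v : Fin 3 → ℤ) →
  sum3 (λ k → sum3 (λ l → a l * n l k) * v k) ≡ sum3 (λ l → a l * sum3 (λ k → n l k * v k))
sum3-swap a n v = expanded (a (# 0)) (a (# 1)) (a (# 2))
  (n (# 0) (# 0)) (n (# 0) (# 1)) (n (# 0) (# 2))
  (n (# 1) (# 0)) (n (# 1) (# 1)) (n (# 1) (# 2))
  (n (# 2) (# 0)) (n (# 2) (# 1)) (n (# 2) (# 2))
  (v (# 0)) (v (# 1)) (v (# 2))
  where
  expanded : ∀ a₁ a₂ a₃ n₁₁ n₁₂ n₁₃ n₂₁ n₂₂ n₂₃ n₃₁ n₃₂ n₃₃ v₁ v₂ v₃ →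
    (a₁ * n₁₁ + (a₂ * n₂₁ + a₃ * n₃₁)) * v₁
      + ((a₁ * n₁₂ + (a₂ * n₂₂ + a₃ * n₃₂)) * v₂ + (a₁ * n₁₃ + (a₂ * n₂₃ + a₃ * n₃₃)) * v₃)
    ≡ a₁ * (n₁₁ * v₁ + (n₁₂ * v₂ + n₁₃ * v₃))
      + (a₂ * (n₂₁ * v₁ + (n₂₂ * v₂ + n₂₃ * v₃)) + a₃ * (n₃₁ * v₁ + (n₃₂ * v₂ + n₃₃ * v₃)))
  expanded = solve-∀

·-entry : ∀ M N i k → lookup (lookup (M · N) i) k ≡ sum3 (λ l → lookup (lookup M i) l * lookup (lookup N l) k)
·-entry M N i k = trans
  (cong (λ row → lookup row k) (lookup∘tabulate (λ i → tabulate λ j → sum3 λ l → lookup (lookup M i) l * lookup (lookup N l) j) i))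
  (lookup∘tabulate (λ j → sum3 λ l → lookup (lookup M i) l * lookup (lookup N l) j) k)

▷-· : ∀ M N v → (M · N) ▷ v ≡ M ▷ (N ▷ v)
▷-· M N v = tabulate-cong λ i →
  trans (sum3-cong (λ k → cong (_* lookup v k) (·-entry M N i k)))
  (trans (sum3-swap (lookup (lookup M i)) (λ l k → lookup (lookup N l) k) (lookup v))
         (sum3-cong (λ l → cong (lookup (lookup M i) l *_)
           (sym (lookup∘tabulate (λ i → sum3 λ k → lookup (lookup N i) k * lookup v k) l)))))

J-▷ : ∀ a b c → J ▷ (a ∷ b ∷ c ∷ []) ≡ (c ∷ b ∷ a ∷ [])
J-▷ a b c = vec3-cong (first a b c) (second a b c) (third a b c)
  where
  first : ∀ a b c → + 0 * a + (+ 0 * b + + 1 * c) ≡ c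
  first = solve-∀
  second : ∀ a b c → + 0 * a + (+ 1 * b + + 0 * c) ≡ b
  second = solve-∀
  third : ∀ a b c → + 1 * a + (+ 0 * b + + 0 * c) ≡ a
  third = solve-∀

-- The rotation (a, b, c) ↦ (p a + 2q b, q a + p b, c); it preserves a² − 2b².
rot : ℤ → ℤ → Vec3 → Vec3
rot p q (a ∷ b ∷ c ∷ []) = (p * a + + 2 * q * b) ∷ (q * a + p * b) ∷ c ∷ []

-- The matrix of that rotation.  B, B⁻¹ and I3 are all of this form.
pellMat : ℤ → ℤ → Mat3
pellMat p q = (p ∷ + 2 * q ∷ + 0 ∷ []) ∷ (q ∷ p ∷ + 0 ∷ []) ∷ (+ 0 ∷ + 0 ∷ + 1 ∷ []) ∷ []

pellMat-▷ : ∀ p q v → pellMat p q ▷ v ≡ rot p q v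
pellMat-▷ p q (a ∷ b ∷ c ∷ []) = vec3-cong (first p q a b c) (second p q a b c) (third p q a b c)
  where
  first : ∀ p q a b c → p * a + (+ 2 * q * b + + 0 * c) ≡ p * a + + 2 * q * b
  first = solve-∀
  second : ∀ p q a b c → q * a + (p * b + + 0 * c) ≡ q * a + p * b
  second = solve-∀
  third : ∀ p q a b c → + 0 * a + (+ 0 * b + + 1 * c) ≡ c
  third = solve-∀

I3-▷ : ∀ v → I3 ▷ v ≡ v
I3-▷ (a ∷ b ∷ c ∷ []) = trans (pellMat-▷ (+ 1) (+ 0) (a ∷ b ∷ c ∷ [])) (vec3-cong (first a b) (second a b) refl)
  where
  first : ∀ a b → + 1 * a + + 2 * + 0 * b ≡ a
  first = solve-∀
  second : ∀ a b → + 0 * a + + 1 * b ≡ b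
  second = solve-∀

-- Rotations compose like the units p + q√2 of ℤ[√2].
rot-∘ : ∀ p q r s v → rot p q (rot r s v) ≡ rot (p * r + + 2 * q * s) (q * r + p * s) v
rot-∘ p q r s (a ∷ b ∷ c ∷ []) = vec3-cong (first p q r s a b) (second p q r s a b) refl
  where
  first : ∀ p q r s a b →
    p * (r * a + + 2 * s * b) + + 2 * q * (s * a + r * b) ≡ (p * r + + 2 * q * s) * a + + 2 * (q * r + p * s) * b
  first = solve-∀
  second : ∀ p q r s a b →
    q * (r * a + + 2 * s * b) + p * (s * a + r * b) ≡ (q * r + p * s) * a + (p * r + + 2 * q * s) * b
  second = solve-∀

norm-multiplicative : ∀ p q r s →
  (p * r + + 2 * q * s) * (p * r + + 2 * q * s) - + 2 * ((q * r + p * s) * (q * r + p * s))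
    ≡ (p * p - + 2 * (q * q)) * (r * r - + 2 * (s * s))
norm-multiplicative = solve-∀

PellUnit : ℤ → ℤ → Set
PellUnit p q = p * p - + 2 * (q * q) ≡ + 1

record PellAction (M : Mat3) : Set where
  constructor pellAction
  field
    p q  : ℤ
    unit : PellUnit p q
    acts : ∀ v → M ▷ v ≡ rot p q v

pellMat-action : ∀ p q → PellUnit p q → PellAction (pellMat p q)
pellMat-action p q unit = pellAction p q unit (pellMat-▷ p q)

PellAction-· : ∀ {M N} → PellAction M → PellAction N → PellAction (M · N)
PellAction-· {M} {N} (pellAction p q unitM actsM) (pellAction r s unitN actsN) =
  pellAction (p * r + + 2 * q * s) (q * r + p * s)
    (trans (norm-multiplicative p q r s) (cong₂ _*_ unitM unitN))
    λ v → begin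
      (M · N) ▷ v                               ≡⟨ ▷-· M N v ⟩
      M ▷ (N ▷ v)                               ≡⟨ cong (M ▷_) (actsN v) ⟩
      M ▷ rot r s v                             ≡⟨ actsM (rot r s v) ⟩
      rot p q (rot r s v)                       ≡⟨ rot-∘ p q r s v ⟩
      rot (p * r + + 2 * q * s) (q * r + p * s) v ∎
  where open ≡-Reasoning

PellAction-^ : ∀ {M} → PellAction M → ∀ k → PellAction (M ^ᴹ k)
PellAction-^ _ zero    = pellMat-action (+ 1) (+ 0) refl
PellAction-^ a (suc k) = PellAction-· a (PellAction-^ a k)

-- Every integer power of B is a Pell rotation: B = pellMat 3 2 and
-- B⁻¹ = pellMat 3 (−2), with 3² − 2·2² = 1.
Bpow-action : ∀ n → PellAction (Bpow n)
Bpow-action (+ n)    = PellAction-^ (pellMat-action (+ 3) (+ 2) refl) n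
Bpow-action -[1+ n ] = PellAction-^ (pellMat-action (+ 3) (- + 2) refl) (suc n)

reverseIf : Fin 2 → Vec3 → Vec3
reverseIf Fin.zero            v                  = v
reverseIf (Fin.suc Fin.zero) (a ∷ b ∷ c ∷ []) = c ∷ b ∷ a ∷ []

Jpow-▷ : ∀ e v → Jpow e ▷ v ≡ reverseIf e v
Jpow-▷ Fin.zero            v                  = I3-▷ v
Jpow-▷ (Fin.suc Fin.zero) (a ∷ b ∷ c ∷ []) = J-▷ a b c

Retraction : Mat3 → Set
Retraction M = Σ (Vec3 → Vec3) λ f → ∀ v → f (M ▷ v) ≡ v

retraction-· : ∀ {L M N} → L · M ≡ I3 → Retraction N → Retraction (M · N)
retraction-· {L} {M} {N} LM≡I (f , f-inv) = (λ u → f (L ▷ u)) , λ v → begin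
  f (L ▷ ((M · N) ▷ v))   ≡⟨ cong (λ u → f (L ▷ u)) (▷-· M N v) ⟩
  f (L ▷ (M ▷ (N ▷ v)))   ≡⟨ cong f (sym (▷-· L M (N ▷ v))) ⟩
  f ((L · M) ▷ (N ▷ v))   ≡⟨ cong (λ K → f (K ▷ (N ▷ v))) LM≡I ⟩
  f (I3 ▷ (N ▷ v))        ≡⟨ cong f (I3-▷ (N ▷ v)) ⟩
  f (N ▷ v)               ≡⟨ f-inv v ⟩
  v                       ∎
  where open ≡-Reasoning

-- Every element of H acts injectively; its generators are inverted by
-- B⁻¹ · B = B · B⁻¹ = J · J = I3.
InH-retraction : ∀ {M} → InH M → Retraction M
InH-retraction H-I            = (λ v → v) , I3-▷
InH-retraction (H-B {M} h)    = retraction-· {Binv} {B} {M} refl (InH-retraction h)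
InH-retraction (H-Binv {M} h) = retraction-· {B} {Binv} {M} refl (InH-retraction h)
InH-retraction (H-J {M} h)    = retraction-· {J} {J} {M} refl (InH-retraction h)

right-inverse-cancels : ∀ {M M′} → InH M → M · M′ ≡ I3 → ∀ v → M′ ▷ (M ▷ v) ≡ v
right-inverse-cancels {M} {M′} M∈H MM′≡I v = begin
  M′ ▷ (M ▷ v)              ≡⟨ sym (f-inv (M′ ▷ (M ▷ v))) ⟩
  f (M ▷ (M′ ▷ (M ▷ v)))    ≡⟨ cong f (sym (▷-· M M′ (M ▷ v))) ⟩
  f ((M · M′) ▷ (M ▷ v))    ≡⟨ cong (λ K → f (K ▷ (M ▷ v))) MM′≡I ⟩
  f (I3 ▷ (M ▷ v))          ≡⟨ cong f (I3-▷ (M ▷ v)) ⟩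
  f (M ▷ v)                 ≡⟨ f-inv v ⟩
  v                         ∎
  where
  open ≡-Reasoning
  f = proj₁ (InH-retraction M∈H)
  f-inv = proj₂ (InH-retraction M∈H)

Mx-▷ : ∀ {M₁ M₃ M₁⁻¹ δ x₁ x₂ x₃ x₄ x₅} → InH M₁ → M₁ · M₁⁻¹ ≡ I3 →
  (x₁ ∷ x₂ ∷ x₃ ∷ []) ≡ M₁ ▷ δ → (x₃ ∷ x₄ ∷ x₅ ∷ []) ≡ M₃ ▷ δ →
  (J · M₃ · M₁⁻¹) ▷ (x₁ ∷ x₂ ∷ x₃ ∷ []) ≡ (x₅ ∷ x₄ ∷ x₃ ∷ [])
Mx-▷ {M₁} {M₃} {M₁⁻¹} {δ} {x₁} {x₂} {x₃} {x₄} {x₅} M₁∈H M₁M₁⁻¹≡I x₁₂₃≡M₁δ x₃₄₅≡M₃δ = begin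
  (J · M₃ · M₁⁻¹) ▷ x₁₂₃         ≡⟨ ▷-· (J · M₃) M₁⁻¹ x₁₂₃ ⟩
  (J · M₃) ▷ (M₁⁻¹ ▷ x₁₂₃)       ≡⟨ ▷-· J M₃ (M₁⁻¹ ▷ x₁₂₃) ⟩
  J ▷ (M₃ ▷ (M₁⁻¹ ▷ x₁₂₃))       ≡⟨ cong (λ w → J ▷ (M₃ ▷ (M₁⁻¹ ▷ w))) x₁₂₃≡M₁δ ⟩
  J ▷ (M₃ ▷ (M₁⁻¹ ▷ (M₁ ▷ δ)))   ≡⟨ cong (λ w → J ▷ (M₃ ▷ w)) (right-inverse-cancels {M′ = M₁⁻¹} M₁∈H M₁M₁⁻¹≡I δ) ⟩
  J ▷ (M₃ ▷ δ)                   ≡⟨ cong (J ▷_) (sym x₃₄₅≡M₃δ) ⟩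
  J ▷ (x₃ ∷ x₄ ∷ x₅ ∷ [])        ≡⟨ J-▷ x₃ x₄ x₅ ⟩
  x₅ ∷ x₄ ∷ x₃ ∷ []              ∎
  where
  open ≡-Reasoning
  x₁₂₃ = x₁ ∷ x₂ ∷ x₃ ∷ []

data Shape (x₁ x₂ x₃ x₄ x₅ : ℤ) : Set where
  x₃≡x₁ : x₃ ≡ x₁ → Shape x₁ x₂ x₃ x₄ x₅
  x₅≡x₃ : x₅ ≡ x₃ → Shape x₁ x₂ x₃ x₄ x₅
  x₅≡x₁ : x₅ ≡ x₁ → Shape x₁ x₂ x₃ x₄ x₅
  pell  : ∀ p q → PellUnit p q → x₄ ≡ q * x₁ + p * x₂ → Shape x₁ x₂ x₃ x₄ x₅

shape-of-rotation : ∀ {x₁ x₂ x₃ x₄ x₅} ℓ r p q → PellUnit p q →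
  reverseIf ℓ (rot p q (reverseIf r (x₁ ∷ x₂ ∷ x₃ ∷ []))) ≡ (x₅ ∷ x₄ ∷ x₃ ∷ []) →
  Shape x₁ x₂ x₃ x₄ x₅
shape-of-rotation Fin.zero            Fin.zero            p q unit eq = pell p q unit (sym (coordinate (# 1) eq))
shape-of-rotation Fin.zero            (Fin.suc Fin.zero) _ _ _    eq = x₃≡x₁ (sym (coordinate (# 2) eq))
shape-of-rotation (Fin.suc Fin.zero) Fin.zero            _ _ _    eq = x₅≡x₃ (sym (coordinate (# 0) eq))
shape-of-rotation (Fin.suc Fin.zero) (Fin.suc Fin.zero) _ _ _    eq = x₅≡x₁ (sym (coordinate (# 0) eq))

shape : ∀ {M x₁ x₂ x₃ x₄ x₅} → LengthAtMostOne M →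
  M ▷ (x₁ ∷ x₂ ∷ x₃ ∷ []) ≡ (x₅ ∷ x₄ ∷ x₃ ∷ []) → Shape x₁ x₂ x₃ x₄ x₅
shape {x₁ = x₁} {x₂} {x₃} {x₄} {x₅} (ℓ , n , r , refl) eq = shape-of-rotation ℓ r p q unit (begin
  reverseIf ℓ (rot p q (reverseIf r v))     ≡⟨ sym (Jpow-▷ ℓ _) ⟩
  Jpow ℓ ▷ rot p q (reverseIf r v)          ≡⟨ cong (Jpow ℓ ▷_) (sym (acts (reverseIf r v))) ⟩
  Jpow ℓ ▷ (Bpow n ▷ reverseIf r v)         ≡⟨ cong (λ w → Jpow ℓ ▷ (Bpow n ▷ w)) (sym (Jpow-▷ r v)) ⟩
  Jpow ℓ ▷ (Bpow n ▷ (Jpow r ▷ v))          ≡⟨ sym (▷-· (Jpow ℓ) (Bpow n) (Jpow r ▷ v)) ⟩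
  (Jpow ℓ · Bpow n) ▷ (Jpow r ▷ v)          ≡⟨ sym (▷-· (Jpow ℓ · Bpow n) (Jpow r) v) ⟩
  (Jpow ℓ · Bpow n · Jpow r) ▷ v            ≡⟨ eq ⟩
  x₅ ∷ x₄ ∷ x₃ ∷ []                         ∎)
  where
  open ≡-Reasoning
  open PellAction (Bpow-action n)
  v = x₁ ∷ x₂ ∷ x₃ ∷ []

-- Linear-combination reasoning: a ≡ b follows from hypotheses lᵢ ≡ rᵢ once
-- a = b + Σ cᵢ (lᵢ − rᵢ) is checked by ring normalisation (the last argument).
combine₁ : ∀ {a b l₁ r₁ : ℤ} c₁ → l₁ ≡ r₁ → a ≡ b + c₁ * (l₁ - r₁) → a ≡ b
combine₁ {b = b} {l₁} c₁ refl h = trans h (solve (b ∷ₗ c₁ ∷ₗ l₁ ∷ₗ []ₗ))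

combine₂ : ∀ {a b l₁ r₁ l₂ r₂ : ℤ} c₁ c₂ → l₁ ≡ r₁ → l₂ ≡ r₂ →
  a ≡ b + (c₁ * (l₁ - r₁) + c₂ * (l₂ - r₂)) → a ≡ b
combine₂ {b = b} {l₁} {_} {l₂} c₁ c₂ refl refl h =
  trans h (solve (b ∷ₗ c₁ ∷ₗ c₂ ∷ₗ l₁ ∷ₗ l₂ ∷ₗ []ₗ))

combine₃ : ∀ {a b l₁ r₁ l₂ r₂ l₃ r₃ : ℤ} c₁ c₂ c₃ → l₁ ≡ r₁ → l₂ ≡ r₂ → l₃ ≡ r₃ →
  a ≡ b + (c₁ * (l₁ - r₁) + c₂ * (l₂ - r₂) + c₃ * (l₃ - r₃)) → a ≡ b
combine₃ {b = b} {l₁} {_} {l₂} {_} {l₃} c₁ c₂ c₃ refl refl refl h =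
  trans h (solve (b ∷ₗ c₁ ∷ₗ c₂ ∷ₗ c₃ ∷ₗ l₁ ∷ₗ l₂ ∷ₗ l₃ ∷ₗ []ₗ))

combine₄ : ∀ {a b l₁ r₁ l₂ r₂ l₃ r₃ l₄ r₄ : ℤ} c₁ c₂ c₃ c₄ →
  l₁ ≡ r₁ → l₂ ≡ r₂ → l₃ ≡ r₃ → l₄ ≡ r₄ →
  a ≡ b + (c₁ * (l₁ - r₁) + c₂ * (l₂ - r₂) + c₃ * (l₃ - r₃) + c₄ * (l₄ - r₄)) → a ≡ b
combine₄ {b = b} {l₁} {_} {l₂} {_} {l₃} {_} {l₄} c₁ c₂ c₃ c₄ refl refl refl refl h =
  trans h (solve (b ∷ₗ c₁ ∷ₗ c₂ ∷ₗ c₃ ∷ₗ c₄ ∷ₗ l₁ ∷ₗ l₂ ∷ₗ l₃ ∷ₗ l₄ ∷ₗ []ₗ))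

square-abs : ∀ x → x * x ≡ + (∣ x ∣ ℕ.* ∣ x ∣)
square-abs (+ n)    = +◃n≡+n (n ℕ.* n)
square-abs -[1+ n ] = refl

square-nonneg : ∀ x k → x * x ≢ -[1+ k ]
square-nonneg x k eq with trans (sym (square-abs x)) eq
... | ()

not-a-square : ∀ x k c → {T (k ℕ.* k ℕ.<ᵇ c)} → {T (c ℕ.<ᵇ suc k ℕ.* suc k)} → x * x ≢ + c
not-a-square x k c {k²<c} {c<sk²} eq =
  not-square k c ∣ x ∣ {k²<c} {c<sk²} (+-injective (trans (sym (square-abs x)) eq))

square-successor-ℤ : ∀ a b → a * a ≡ b * b + + 1 → b * b ≡ + 0
square-successor-ℤ a b eq = trans (square-abs b) (cong (λ n → + (n ℕ.* n))
  (square-successor ∣ a ∣ ∣ b ∣ (+-injective (trans (sym (square-abs a)) (trans eq (cong (_+ + 1) (square-abs b)))))))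

abs-cases : ∀ z n → ∣ z ∣ ≡ suc n → z ≡ + suc n ⊎ z ≡ -[1+ n ]
abs-cases (+ _)    _ refl = inj₁ refl
abs-cases -[1+ _ ] _ refl = inj₂ refl

pell-abs : ∀ p q → PellUnit p q → ∣ p ∣ ℕ.* ∣ p ∣ ≡ 1 ℕ.+ 2 ℕ.* (∣ q ∣ ℕ.* ∣ q ∣)
pell-abs p q unit = +-injective (begin
  + (∣ p ∣ ℕ.* ∣ p ∣)              ≡⟨ sym (square-abs p) ⟩
  p * p                            ≡⟨ p²≡ ⟩
  + 1 + + 2 * (q * q)              ≡⟨ cong (λ s → + 1 + + 2 * s) (square-abs q) ⟩
  + 1 + + 2 * + (∣ q ∣ ℕ.* ∣ q ∣)  ≡⟨ cong (λ s → + 1 + s) (sym (pos-* 2 (∣ q ∣ ℕ.* ∣ q ∣))) ⟩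
  + (1 ℕ.+ 2 ℕ.* (∣ q ∣ ℕ.* ∣ q ∣)) ∎)
  where
  open ≡-Reasoning
  p²≡ : p * p ≡ + 1 + + 2 * (q * q)
  p²≡ = combine₁ (+ 1) unit (solve (p ∷ₗ q ∷ₗ []ₗ))

steep-square-bound : ∀ k T u x → 36 ℕ.< T → + k * + T + + 36 ≡ u * u + + T * (x * x) →
  ∣ x ∣ ℕ.* ∣ x ∣ ℕ.≤ k
steep-square-bound k T u x 36<T eq = steep-bound k 36 T _ _ 36<T (+-injective (begin
  + (k ℕ.* T ℕ.+ 36)                  ≡⟨ pos-+ (k ℕ.* T) 36 ⟩
  + (k ℕ.* T) + + 36                  ≡⟨ cong (_+ + 36) (pos-* k T) ⟩
  + k * + T + + 36                    ≡⟨ eq ⟩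
  u * u + + T * (x * x)               ≡⟨ cong₂ (λ U S → U + + T * S) (square-abs u) (square-abs x) ⟩
  + U + + T * + S                     ≡⟨ cong (λ s → + U + s) (sym (pos-* T S)) ⟩
  + U + + (T ℕ.* S)                   ≡⟨ sym (pos-+ U (T ℕ.* S)) ⟩
  + (U ℕ.+ T ℕ.* S)                   ∎))
  where
  open ≡-Reasoning
  U = ∣ u ∣ ℕ.* ∣ u ∣
  S = ∣ x ∣ ℕ.* ∣ x ∣

-- Completing the square in the form (q²+2)x² + 2pq xy + (2q²−2)y² = 6; by the
-- Pell relation its determinant (q²+2)(2q²−2) − p²q² equals T = q² − 4.
complete-square-x : ∀ p q x y → PellUnit p q →
  (q * q + + 2) * (x * x) + + 2 * (p * q) * (x * y) + (+ 2 * (q * q) - + 2) * (y * y) ≡ + 6 →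
  + 6 * (q * q - + 4) + + 36
    ≡ ((q * q + + 2) * x + p * q * y) * ((q * q + + 2) * x + p * q * y) + (q * q - + 4) * (y * y)
complete-square-x p q x y unit form =
  combine₂ (- (q * q + + 2)) (- (q * q * (y * y))) form unit (solve (p ∷ₗ q ∷ₗ x ∷ₗ y ∷ₗ []ₗ))

complete-square-y : ∀ p q x y → PellUnit p q →
  (q * q + + 2) * (x * x) + + 2 * (p * q) * (x * y) + (+ 2 * (q * q) - + 2) * (y * y) ≡ + 6 →
  + 12 * (q * q - + 4) + + 36
    ≡ ((+ 2 * (q * q) - + 2) * y + p * q * x) * ((+ 2 * (q * q) - + 2) * y + p * q * x) + (q * q - + 4) * (x * x)
complete-square-y p q x y unit form =
  combine₂ (- (+ 2 * (q * q) - + 2)) (- (q * q * (x * x))) form unit (solve (p ∷ₗ q ∷ₗ x ∷ₗ y ∷ₗ []ₗ))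

module Büchi (x₁ x₂ x₃ x₄ x₅ : ℤ)
  (E₁ : x₃ * x₃ + - (+ 2 * (x₂ * x₂)) + x₁ * x₁ ≡ + 2)
  (E₂ : x₄ * x₄ + - (+ 2 * (x₃ * x₃)) + x₂ * x₂ ≡ + 2)
  (E₃ : x₅ * x₅ + - (+ 2 * (x₄ * x₄)) + x₃ * x₃ ≡ + 2) where

  trivial-from-start : ∀ m → x₁ * x₁ ≡ (m + + 1) * (m + + 1) → x₂ * x₂ ≡ (m + + 2) * (m + + 2) →
    Trivial5 x₁ x₂ x₃ x₄ x₅
  trivial-from-start m h₁ h₂ = m , h₁ , h₂ , h₃ , h₄ , h₅
    where
    h₃ : x₃ * x₃ ≡ (m + + 3) * (m + + 3)
    h₃ = combine₃ (+ 1) (+ 2) (- + 1) E₁ h₂ h₁ (solve (x₁ ∷ₗ x₂ ∷ₗ x₃ ∷ₗ m ∷ₗ []ₗ))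
    h₄ : x₄ * x₄ ≡ (m + + 4) * (m + + 4)
    h₄ = combine₃ (+ 1) (+ 2) (- + 1) E₂ h₃ h₂ (solve (x₂ ∷ₗ x₃ ∷ₗ x₄ ∷ₗ m ∷ₗ []ₗ))
    h₅ : x₅ * x₅ ≡ (m + + 5) * (m + + 5)
    h₅ = combine₃ (+ 1) (+ 2) (- + 1) E₃ h₄ h₃ (solve (x₃ ∷ₗ x₄ ∷ₗ x₅ ∷ₗ m ∷ₗ []ₗ))

  x₁²-from : ∀ {a b} → x₂ * x₂ ≡ a → x₃ * x₃ ≡ b → x₁ * x₁ ≡ + 2 + + 2 * a - b
  x₁²-from {a} {b} h₂ h₃ = combine₃ (+ 1) (+ 2) (- + 1) E₁ h₂ h₃ (solve (x₁ ∷ₗ x₂ ∷ₗ x₃ ∷ₗ a ∷ₗ b ∷ₗ []ₗ))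

  x₂²-from : ∀ {a b} → x₃ * x₃ ≡ a → x₄ * x₄ ≡ b → x₂ * x₂ ≡ + 2 + + 2 * a - b
  x₂²-from {a} {b} h₃ h₄ = combine₃ (+ 1) (+ 2) (- + 1) E₂ h₃ h₄ (solve (x₂ ∷ₗ x₃ ∷ₗ x₄ ∷ₗ a ∷ₗ b ∷ₗ []ₗ))

  x₃²-from : ∀ {a b} → x₁ * x₁ ≡ a → x₂ * x₂ ≡ b → x₃ * x₃ ≡ + 2 + + 2 * b - a
  x₃²-from {a} {b} h₁ h₂ = combine₃ (+ 1) (+ 2) (- + 1) E₁ h₂ h₁ (solve (x₁ ∷ₗ x₂ ∷ₗ x₃ ∷ₗ a ∷ₗ b ∷ₗ []ₗ))

  -- Neighbouring squares differing by one are 1 and 0, which pins down the start.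
  -- x₂² = x₃² + 1 gives (x₁², x₂², x₃²) = (4, 1, 0).
  trivial-if-x₂²≡x₃²+1 : x₂ * x₂ ≡ x₃ * x₃ + + 1 → Trivial5 x₁ x₂ x₃ x₄ x₅
  trivial-if-x₂²≡x₃²+1 h = trivial-from-start -[1+ 2 ] (x₁²-from x₂²≡1 x₃²≡0) x₂²≡1
    where
    x₃²≡0 : x₃ * x₃ ≡ + 0
    x₃²≡0 = square-successor-ℤ x₂ x₃ h
    x₂²≡1 : x₂ * x₂ ≡ + 1
    x₂²≡1 = trans h (cong (_+ + 1) x₃²≡0)

  -- x₃² = x₂² + 1 gives (x₁², x₂², x₃²) = (1, 0, 1).
  trivial-if-x₃²≡x₂²+1 : x₃ * x₃ ≡ x₂ * x₂ + + 1 → Trivial5 x₁ x₂ x₃ x₄ x₅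
  trivial-if-x₃²≡x₂²+1 h = trivial-from-start -[1+ 1 ] (x₁²-from x₂²≡0 x₃²≡1) x₂²≡0
    where
    x₂²≡0 : x₂ * x₂ ≡ + 0
    x₂²≡0 = square-successor-ℤ x₃ x₂ h
    x₃²≡1 : x₃ * x₃ ≡ + 1
    x₃²≡1 = trans h (cong (_+ + 1) x₂²≡0)

  -- x₃² = x₄² + 1 gives (x₁², x₂², x₃², x₄²) = (9, 4, 1, 0).
  trivial-if-x₃²≡x₄²+1 : x₃ * x₃ ≡ x₄ * x₄ + + 1 → Trivial5 x₁ x₂ x₃ x₄ x₅
  trivial-if-x₃²≡x₄²+1 h = trivial-from-start -[1+ 3 ] (x₁²-from x₂²≡4 x₃²≡1) x₂²≡4
    where
    x₄²≡0 : x₄ * x₄ ≡ + 0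
    x₄²≡0 = square-successor-ℤ x₃ x₄ h
    x₃²≡1 : x₃ * x₃ ≡ + 1
    x₃²≡1 = trans h (cong (_+ + 1) x₄²≡0)
    x₂²≡4 : x₂ * x₂ ≡ + 4
    x₂²≡4 = x₂²-from x₃²≡1 x₄²≡0

  trivial-if-x₃≡x₁ : x₃ ≡ x₁ → Trivial5 x₁ x₂ x₃ x₄ x₅
  trivial-if-x₃≡x₁ h = trivial-if-x₃²≡x₂²+1 (*-cancelˡ-≡ (+ 2) _ _
    (combine₂ (+ 1) (x₃ + x₁) E₁ h (solve (x₁ ∷ₗ x₂ ∷ₗ x₃ ∷ₗ []ₗ))))

  trivial-if-x₅≡x₃ : x₅ ≡ x₃ → Trivial5 x₁ x₂ x₃ x₄ x₅
  trivial-if-x₅≡x₃ h = trivial-if-x₃²≡x₄²+1 (*-cancelˡ-≡ (+ 2) _ _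
    (combine₂ (+ 1) (- (x₅ + x₃)) E₃ h (solve (x₃ ∷ₗ x₄ ∷ₗ x₅ ∷ₗ []ₗ))))

  trivial-if-x₅≡x₁ : x₅ ≡ x₁ → Trivial5 x₁ x₂ x₃ x₄ x₅
  trivial-if-x₅≡x₁ h = trivial-if-x₂²≡x₃²+1 (*-cancelˡ-≡ (+ 4) _ _
    (combine₄ (- + 1) (+ 2) (+ 1) (- (x₅ + x₁)) E₁ E₂ E₃ h (solve (x₁ ∷ₗ x₂ ∷ₗ x₃ ∷ₗ x₄ ∷ₗ x₅ ∷ₗ []ₗ))))

  -- In the Pell shape, x₄² = 6 + 3x₂² − 2x₁² becomes a binary quadratic equation.
  quadratic-form : ∀ p q → PellUnit p q → x₄ ≡ q * x₁ + p * x₂ →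
    (q * q + + 2) * (x₁ * x₁) + + 2 * (p * q) * (x₁ * x₂) + (+ 2 * (q * q) - + 2) * (x₂ * x₂) ≡ + 6
  quadratic-form p q unit h₄ = combine₄ (+ 2) (+ 1) (- (x₄ + (q * x₁ + p * x₂))) (- (x₂ * x₂)) E₁ E₂ h₄ unit
    (solve (x₁ ∷ₗ x₂ ∷ₗ x₃ ∷ₗ x₄ ∷ₗ p ∷ₗ q ∷ₗ []ₗ))

  -- q = 0: then p² = 1, so x₄² = x₂² and the second equation gives x₂² = x₃² + 1.
  trivial-if-q≡0 : ∀ p q → q ≡ + 0 → PellUnit p q → x₄ ≡ q * x₁ + p * x₂ → Trivial5 x₁ x₂ x₃ x₄ x₅
  trivial-if-q≡0 p _ refl unit h₄ = trivial-if-x₂²≡x₃²+1 (*-cancelˡ-≡ (+ 2) _ _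
    (combine₃ (+ 1) (- (x₄ + (+ 0 * x₁ + p * x₂))) (- (x₂ * x₂)) E₂ h₄ unit
      (solve (x₁ ∷ₗ x₂ ∷ₗ x₃ ∷ₗ x₄ ∷ₗ p ∷ₗ []ₗ))))

  -- |q| = 2 (so |p| = 3): the form is 6(x₁ + εx₂)² = 6 with ε = ±1.  Then
  -- u = x₁ + εx₂ = ±1 and x₁², x₂² are the consecutive squares (uεx₂ − 1)², (uεx₂)².
  trivial-if-unit-form : ∀ ε → ε * ε ≡ + 1 →
    + 6 * (x₁ * x₁) + + 12 * ε * (x₁ * x₂) + + 6 * (x₂ * x₂) ≡ + 6 → Trivial5 x₁ x₂ x₃ x₄ x₅
  trivial-if-unit-form ε ε²≡1 form = trivial-from-start ((x₁ + ε * x₂) * ε * x₂ - + 2) x₁²≡ x₂²≡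
    where
    u²≡1 : (x₁ + ε * x₂) * (x₁ + ε * x₂) ≡ + 1
    u²≡1 = *-cancelˡ-≡ (+ 6) _ _
      (combine₂ (+ 1) (+ 6 * (x₂ * x₂)) form ε²≡1 (solve (x₁ ∷ₗ x₂ ∷ₗ ε ∷ₗ []ₗ)))
    x₁²≡ : x₁ * x₁ ≡ ((x₁ + ε * x₂) * ε * x₂ - + 2 + + 1) * ((x₁ + ε * x₂) * ε * x₂ - + 2 + + 1)
    x₁²≡ = combine₁ (+ 1 - ε * ε * (x₂ * x₂)) u²≡1 (solve (x₁ ∷ₗ x₂ ∷ₗ ε ∷ₗ []ₗ))
    x₂²≡ : x₂ * x₂ ≡ ((x₁ + ε * x₂) * ε * x₂ - + 2 + + 2) * ((x₁ + ε * x₂) * ε * x₂ - + 2 + + 2)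
    x₂²≡ = combine₂ (- (ε * ε * (x₂ * x₂))) (- (x₂ * x₂)) u²≡1 ε²≡1 (solve (x₁ ∷ₗ x₂ ∷ₗ ε ∷ₗ []ₗ))

  trivial-if-∣q∣≡2 : ∀ p q → ∣ q ∣ ≡ 2 → PellUnit p q → x₄ ≡ q * x₁ + p * x₂ → Trivial5 x₁ x₂ x₃ x₄ x₅
  trivial-if-∣q∣≡2 p q ∣q∣≡2 unit h₄
    with abs-cases q 1 ∣q∣≡2
       | abs-cases p 2 (square-injective ∣ p ∣ 3 (trans (pell-abs p q unit) (cong (λ k → 1 ℕ.+ 2 ℕ.* (k ℕ.* k)) ∣q∣≡2)))
  ... | inj₁ refl | inj₁ refl = trivial-if-unit-form (+ 1)   refl (quadratic-form (+ 3) (+ 2) unit h₄)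
  ... | inj₂ refl | inj₁ refl = trivial-if-unit-form (- + 1) refl (quadratic-form (+ 3) (- + 2) unit h₄)
  ... | inj₁ refl | inj₂ refl = trivial-if-unit-form (- + 1) refl (quadratic-form (- + 3) (+ 2) unit h₄)
  ... | inj₂ refl | inj₂ refl = trivial-if-unit-form (+ 1)   refl (quadratic-form (- + 3) (- + 2) unit h₄)

  -- The finitely many starts with |x₁| ≤ 3, |x₂| ≤ 2: either x₃² = 2 + 2x₂² − x₁²
  -- is not a square, or x₁², x₂² are consecutive squares.
  small-search : ∀ a b → a ℕ.≤ 3 → b ℕ.≤ 2 → x₁ * x₁ ≡ + (a ℕ.* a) → x₂ * x₂ ≡ + (b ℕ.* b) →
    Trivial5 x₁ x₂ x₃ x₄ x₅
  small-search (suc (suc (suc (suc _)))) _ (ℕ.s≤s (ℕ.s≤s (ℕ.s≤s ()))) _ _ _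
  small-search _ (suc (suc (suc _))) _ (ℕ.s≤s (ℕ.s≤s ())) _ _
  small-search 0 0 _ _ h₁ h₂ = ⊥-elim (not-a-square x₃ 1 2 (x₃²-from h₁ h₂))
  small-search 1 0 _ _ h₁ h₂ = trivial-from-start -[1+ 1 ] h₁ h₂
  small-search 2 0 _ _ h₁ h₂ = ⊥-elim (square-nonneg x₃ 1 (x₃²-from h₁ h₂))
  small-search 3 0 _ _ h₁ h₂ = ⊥-elim (square-nonneg x₃ 6 (x₃²-from h₁ h₂))
  small-search 0 1 _ _ h₁ h₂ = trivial-from-start -[1+ 0 ] h₁ h₂
  small-search 1 1 _ _ h₁ h₂ = ⊥-elim (not-a-square x₃ 1 3 (x₃²-from h₁ h₂))
  small-search 2 1 _ _ h₁ h₂ = trivial-from-start -[1+ 2 ] h₁ h₂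
  small-search 3 1 _ _ h₁ h₂ = ⊥-elim (square-nonneg x₃ 4 (x₃²-from h₁ h₂))
  small-search 0 2 _ _ h₁ h₂ = ⊥-elim (not-a-square x₃ 3 10 (x₃²-from h₁ h₂))
  small-search 1 2 _ _ h₁ h₂ = trivial-from-start (+ 0) h₁ h₂
  small-search 2 2 _ _ h₁ h₂ = ⊥-elim (not-a-square x₃ 2 6 (x₃²-from h₁ h₂))
  small-search 3 2 _ _ h₁ h₂ = trivial-from-start -[1+ 3 ] h₁ h₂

  -- |q| ≥ 7: with T = q² − 4 > 36, completing the square gives
  -- 6T + 36 ≥ T x₂² and 12T + 36 ≥ T x₁², so x₂² ≤ 6 and x₁² ≤ 12.
  trivial-if-steep : ∀ p q → 7 ℕ.≤ ∣ q ∣ → PellUnit p q → x₄ ≡ q * x₁ + p * x₂ → Trivial5 x₁ x₂ x₃ x₄ x₅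
  trivial-if-steep p q 7≤∣q∣ unit h₄ =
    small-search ∣ x₁ ∣ ∣ x₂ ∣ ∣x₁∣≤3 ∣x₂∣≤2 (square-abs x₁) (square-abs x₂)
    where
    form = quadratic-form p q unit h₄
    u = (q * q + + 2) * x₁ + p * q * x₂
    w = (+ 2 * (q * q) - + 2) * x₂ + p * q * x₁
    41≤q² : 41 ℕ.≤ ∣ q ∣ ℕ.* ∣ q ∣
    41≤q² = ℕₚ.≤-trans (ℕₚ.m≤m+n 41 8) (ℕₚ.*-mono-≤ 7≤∣q∣ 7≤∣q∣)
    excess = ℕₚ.m≤n⇒∃[o]m+o≡n 41≤q²
    t = proj₁ excess
    T≡ : q * q - + 4 ≡ + (37 ℕ.+ t)
    T≡ = cong (_- + 4) (trans (square-abs q) (cong +_ (sym (proj₂ excess))))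
    36<T : 36 ℕ.< 37 ℕ.+ t
    36<T = ℕₚ.m≤m+n 37 t
    ∣x₂∣≤2 : ∣ x₂ ∣ ℕ.≤ 2
    ∣x₂∣≤2 = root-bound ∣ x₂ ∣ 2 6
      (steep-square-bound 6 (37 ℕ.+ t) u x₂ 36<T
        (subst (λ T → + 6 * T + + 36 ≡ u * u + T * (x₂ * x₂)) T≡ (complete-square-x p q x₁ x₂ unit form)))
      (ℕₚ.<ᵇ⇒< 6 9 _)
    ∣x₁∣≤3 : ∣ x₁ ∣ ℕ.≤ 3
    ∣x₁∣≤3 = root-bound ∣ x₁ ∣ 3 12
      (steep-square-bound 12 (37 ℕ.+ t) w x₁ 36<T
        (subst (λ T → + 12 * T + + 36 ≡ w * w + T * (x₁ * x₁)) T≡ (complete-square-y p q x₁ x₂ unit form)))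
      (ℕₚ.<ᵇ⇒< 12 16 _)

  -- The Pell shape, by the size of |q|: 1, 3, 4, 5, 6 are not Pell partners
  -- (1 + 2q² = 3, 19, 33, 51, 73 is not a square).
  trivial-if-pell : ∀ p q → PellUnit p q → x₄ ≡ q * x₁ + p * x₂ → Trivial5 x₁ x₂ x₃ x₄ x₅
  trivial-if-pell p q unit h₄ = by-size ∣ q ∣ refl
    where
    pell-at : ∀ {k} → ∣ q ∣ ≡ k → ∣ p ∣ ℕ.* ∣ p ∣ ≡ 1 ℕ.+ 2 ℕ.* (k ℕ.* k)
    pell-at refl = pell-abs p q unit
    by-size : ∀ k → ∣ q ∣ ≡ k → Trivial5 x₁ x₂ x₃ x₄ x₅
    by-size 0 e = trivial-if-q≡0 p q (∣i∣≡0⇒i≡0 e) unit h₄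
    by-size 1 e = ⊥-elim (not-square 1 3 ∣ p ∣ (pell-at e))
    by-size 2 e = trivial-if-∣q∣≡2 p q e unit h₄
    by-size 3 e = ⊥-elim (not-square 4 19 ∣ p ∣ (pell-at e))
    by-size 4 e = ⊥-elim (not-square 5 33 ∣ p ∣ (pell-at e))
    by-size 5 e = ⊥-elim (not-square 7 51 ∣ p ∣ (pell-at e))
    by-size 6 e = ⊥-elim (not-square 8 73 ∣ p ∣ (pell-at e))
    by-size (suc (suc (suc (suc (suc (suc (suc j))))))) e =
      trivial-if-steep p q (subst (7 ℕ.≤_) (sym e) (ℕₚ.m≤m+n 7 j)) unit h₄

  trivial-from-shape : Shape x₁ x₂ x₃ x₄ x₅ → Trivial5 x₁ x₂ x₃ x₄ x₅
  trivial-from-shape (x₃≡x₁ h)        = trivial-if-x₃≡x₁ h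
  trivial-from-shape (x₅≡x₃ h)        = trivial-if-x₅≡x₃ h
  trivial-from-shape (x₅≡x₁ h)        = trivial-if-x₅≡x₁ h
  trivial-from-shape (pell p q unit h) = trivial-if-pell p q unit h

theorem9p2 : (x₁ x₂ x₃ x₄ x₅ : ℤ) → IsBuchi5 x₁ x₂ x₃ x₄ x₅ →
    (δ : Vec3) → δ ≡ δ₁ ⊎ δ ≡ δ₂ →
    (M₁ M₃ : Mat3) → InH M₁ → InH M₃ →
    (x₁ ∷ x₂ ∷ x₃ ∷ []) ≡ M₁ ▷ δ → (x₃ ∷ x₄ ∷ x₅ ∷ []) ≡ M₃ ▷ δ →
    (M₁⁻¹ : Mat3) → M₁ · M₁⁻¹ ≡ I3 →
    LengthAtMostOne (J · M₃ · M₁⁻¹) →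
    Trivial5 x₁ x₂ x₃ x₄ x₅
theorem9p2 x₁ x₂ x₃ x₄ x₅ (E₁ , E₂ , E₃) δ _ M₁ M₃ M₁∈H _ x₁₂₃≡M₁δ x₃₄₅≡M₃δ M₁⁻¹ M₁M₁⁻¹≡I short =
  Büchi.trivial-from-shape x₁ x₂ x₃ x₄ x₅ E₁ E₂ E₃
    (shape {J · M₃ · M₁⁻¹} short (Mx-▷ {M₁} {M₃} {M₁⁻¹} {δ} M₁∈H M₁M₁⁻¹≡I x₁₂₃≡M₁δ x₃₄₅≡M₃δ))
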